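{- Let $Z$ be an $n$-dimensional fake weighted projective space, and fix an isomorphism $\mathrm{Cl}(Z)\cong\mathbb{Z}\oplus\mathbb{Z}/\mu_1\mathbb{Z}\oplus\dots\oplus\mathbb{Z}/\mu_r\mathbb{Z}$ (with $\mu_r\mid\dots\mid\mu_1$) under which the classes of the torus-invariant prime divisors $D_0,\dots,D_n$ correspond to $\omega_i=(w_i,\eta_i)$ with $w_i\in\mathbb{Z}_{\ge1}$ and $\eta_i=(\eta_{i1},\dots,\eta_{ir})$, $\eta_{ij}\in\mathbb{Z}/\mu_j\mathbb{Z}$. Let $\eta'_{ij}\in\{0,\dots,\mu_j-1\}$ represent $\eta_{ij}$, and set $L=\mathrm{lcm}(w_0,\dots,w_n)$, $L_{ij}=\frac{L}{w_i}\eta'_{ij}$, $M_j=\frac{\mu_j}{\gcd(\mu_j,L_{0j},\dots,L_{nj})}$. Then $Z$ is Gorenstein if and only if $L\mid\sum_i w_i$, $M_j\mid\frac{\sum_i w_i}{L}$ for all $j=1,\dots,r$, and $\eta_{nj}=-(\eta_{0j}+\dots+\eta_{n-1,j})$ in $\mathbb{Z}/\mu_j\mathbb{Z}$ for all $j=1,\dots,r$.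
   Context: A fake weighted projective space (fwps) of dimension $n$ is the toric variety $Z=Z(P)$ whose fan has as maximal cones the cones over the facets of $\mathrm{conv}(v_0,\dots,v_n)$, where $P=[v_0,\dots,v_n]$ is an integer $n\times(n+1)$ matrix whose columns are pairwise distinct primitive vectors generating $\mathbb{R}^n$ as a convex cone. Its class group is $\mathrm{Cl}(Z)\cong\mathbb{Z}^{n+1}/\mathrm{im}(P^T)$, with $e_i$ mapping to the class of the torus-invariant prime divisor $D_i$ corresponding to $v_i$. The anticanonical class is $\sum_i[D_i]$; $Z$ is Gorenstein if the anticanonical divisor is Cartier. -}

module Defs where

open import Data.Nat as ℕ using (ℕ; zero; suc)
open import Data.Nat.DivMod using (_/_)
open import Data.Nat.GCD using (gcd)
open import Data.Nat.LCM using (lcm)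
import Data.Nat.Divisibility as ℕD
open import Data.Integer as ℤ using (ℤ; +_; -_; _-_; ∣_∣)
import Data.Integer.Divisibility as ℤD
open import Data.Fin using (Fin; zero; suc; fromℕ; inject₁)
open import Data.Product using (Σ; ∃; ∃-syntax; _×_)
open import Relation.Binary.PropositionalEquality using (_≡_; _≢_)
open import Function.Bundles using (_⇔_)

sumℕ : ∀ {k} → (Fin k → ℕ) → ℕ
sumℕ {zero}  f = 0
sumℕ {suc k} f = f zero ℕ.+ sumℕ (λ i → f (suc i))

sumℤ : ∀ {k} → (Fin k → ℤ) → ℤ
sumℤ {zero}  f = + 0
sumℤ {suc k} f = f zero ℤ.+ sumℤ (λ i → f (suc i))

lcmAll : ∀ {k} → (Fin k → ℕ) → ℕ
lcmAll {zero}  f = 1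
lcmAll {suc k} f = lcm (f zero) (lcmAll (λ i → f (suc i)))

gcdWith : ∀ {k} → ℕ → (Fin k → ℕ) → ℕ
gcdWith {zero}  m f = m
gcdWith {suc k} m f = gcd (gcdWith m (λ i → f (suc i))) (f zero)

-- natural-number division, total (division by 0 returns 0; only ever
-- used here with nonzero divisors)
divℕ : ℕ → ℕ → ℕ
divℕ m zero    = 0
divℕ m (suc d) = m / suc d

dot : ∀ {n} → (Fin n → ℤ) → (Fin n → ℤ) → ℤ
dot u v = sumℤ (λ k → u k ℤ.* v k)

-- An integer n × (n+1) matrix P = [v_0, ..., v_n]; entry (row k, column i).
Matrix : ℕ → Set
Matrix n = Fin n → Fin (suc n) → ℤ

col : ∀ {n} → Matrix n → Fin (suc n) → (Fin n → ℤ)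
col P i = λ k → P k i

-- Columns pairwise distinct, primitive, and generating ℝ^n as a convex
-- cone (stated equivalently over ℚ: every integer vector u has a positive
-- multiple that is a nonnegative integer combination of the columns).
record IsFWPS {n : ℕ} (P : Matrix n) : Set where
  field
    distinct  : ∀ i i′ → (∀ k → P k i ≡ P k i′) → i ≡ i′
    primitiveCols : ∀ i (d : ℕ) → (∀ k → d ℕD.∣ ∣ P k i ∣) → d ≡ 1
    spanning  : ∀ (u : Fin n → ℤ) →
                Σ (Fin (suc n) → ℕ) λ c → Σ ℕ λ d → (∀ (k : Fin n) → + suc d ℤ.* u k ≡ sumℤ (λ i → + c i ℤ.* P k i))

-- Gorenstein: the anticanonical divisor Σ D_i is Cartier, i.e. for every
-- maximal cone σ_i = cone(v_k : k ≠ i) (cone over the facet of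
-- conv(v_0,...,v_n) omitting v_i) there is m_i ∈ ℤ^n with
-- ⟨m_i, v_k⟩ = -1 for all k ≠ i  (Cox–Little–Schenck Thm 4.2.8).
Gorenstein : ∀ {n} → Matrix n → Set
Gorenstein {n} P =
  ∀ (i : Fin (suc n)) → ∃[ m ] (∀ k → k ≢ i → dot m (col P k) ≡ - (+ 1))

-- The isomorphism Cl(Z) = ℤ^{n+1}/im(Pᵀ) ≅ ℤ ⊕ ℤ/μ₁ ⊕ ... ⊕ ℤ/μ_r
-- sending [D_i] = [e_i] to ω_i = (w_i, η_i), η_ij represented by η i j.
-- The induced homomorphism ℤ^{n+1} → ℤ ⊕ ⨁ ℤ/μ_j is
--   a ↦ (Σ a_i w_i , (Σ a_i η_ij mod μ_j)_j);
-- it induces an isomorphism on Cl(Z) iff it is surjective with kernel im(Pᵀ).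

φw : ∀ {n} → (Fin (suc n) → ℕ) → (Fin (suc n) → ℤ) → ℤ
φw w a = sumℤ (λ i → a i ℤ.* + w i)

φη : ∀ {n r} → (Fin (suc n) → Fin r → ℕ) → (Fin (suc n) → ℤ) → Fin r → ℤ
φη η a j = sumℤ (λ i → a i ℤ.* + η i j)

record IsClIso {n r : ℕ} (P : Matrix n) (w : Fin (suc n) → ℕ)
               (μ : Fin r → ℕ) (η : Fin (suc n) → Fin r → ℕ) : Set where
  field
    surjective : ∀ (z : ℤ) (t : Fin r → ℤ) →
                 ∃[ a ] (φw w a ≡ z × (∀ j → + μ j ℤD.∣ (φη η a j - t j)))
    kernel     : ∀ (a : Fin (suc n) → ℤ) →
                 (φw w a ≡ + 0 × (∀ j → + μ j ℤD.∣ φη η a j))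
                 ⇔ (∃[ m ] (∀ i → a i ≡ dot m (col P i)))

Lw : ∀ {n} → (Fin (suc n) → ℕ) → ℕ
Lw w = lcmAll w

Lij : ∀ {n r} → (Fin (suc n) → ℕ) → (Fin (suc n) → Fin r → ℕ) →
      Fin (suc n) → Fin r → ℕ
Lij w η i j = divℕ (Lw w) (w i) ℕ.* η i j

Mj : ∀ {n r} → (Fin (suc n) → ℕ) → (Fin r → ℕ) →
     (Fin (suc n) → Fin r → ℕ) → Fin r → ℕ
Mj w μ η j = divℕ (μ j) (gcdWith (μ j) (λ i → Lij w η i j))

_≡_[mod_] : ℤ → ℤ → ℕ → Set
a ≡ b [mod m ] = + m ℤD.∣ (a - b)

{-# OPTIONS --safe #-}
-- A torus-invariant divisor Σ_k a_k D_k is principal exactly when a_k = ⟨m, v_k⟩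
-- for some m, so Z is Gorenstein iff for every i the anticanonical class Σ_k ω_k
-- equals q_i ω_i for some integer q_i (take a_k = -1 for k ≠ i and a_i = q_i - 1).
-- On the free part this says q_i w_i = Σ w, solvable for all i iff L ∣ Σ w, and then
-- q_i = (Σ w / L)(L / w_i).  Writing the generator (1, 0) of the free part as
-- Σ b_i ω_i shows that the torsion part of Σ_k ω_k vanishes, which is the last
-- condition; after that, q_i η_ij ≡ 0 (mod μ_j) for all i is, by a gcd computation,
-- the divisibility M_j ∣ Σ w / L.
module Submission where

open import Defs
open import Data.Nat using (ℕ; suc; _≤_; _<_)
open import Data.Nat.Divisibility using (_∣_)
open import Data.Integer using (ℤ; +_; -_)
open import Data.Fin using (Fin; fromℕ; inject₁) renaming (_≤_ to _≤ᶠ_)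
open import Data.Product using (_×_)
open import Function.Bundles using (_⇔_)

open import Data.Nat as ℕ using (zero)
import Data.Nat.Properties as ℕP
import Data.Nat.Divisibility as ℕD
open import Data.Nat.DivMod using (m/n*n≡m)
open import Data.Nat.GCD using (gcd[m,n]∣m; gcd[m,n]∣n; gcd-greatest; c*gcd[m,n]≡gcd[cm,cn])
open import Data.Nat.LCM using (m∣lcm[m,n]; n∣lcm[m,n]; lcm-least)
open import Data.Integer using (_+_; _*_; _-_; 0ℤ; 1ℤ; -1ℤ)
import Data.Integer.Properties as ℤP
import Data.Integer.Divisibility as ℤD
open import Data.Integer.Divisibility.Signed as ℤ∣ using () renaming (_∣_ to _∣ℤ_)
open import Data.Integer.Tactic.RingSolver using (solve-∀)
open import Data.Fin using (zero; suc; punchIn)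
open import Data.Fin.Properties using (punchInᵢ≢i)
open import Data.Vec.Functional using (updateAt)
open import Data.Vec.Functional.Properties using (updateAt-updates; updateAt-minimal)
open import Data.Product using (_,_; proj₁; proj₂; map₂; ∃-syntax)
open import Data.Empty using (⊥-elim)
open import Function.Bundles using (mk⇔; Equivalence)
open import Function.Construct.Composition using (_⇔-∘_)
open import Relation.Binary.PropositionalEquality
  using (_≡_; _≢_; refl; sym; trans; cong; cong₂; subst; module ≡-Reasoning)
open import Algebra.Properties.Semiring.Sum ℤP.+-*-semiring
  using (sum; sum-cong-≗; ∑-distrib-+; *-distribˡ-sum; sum-init-last; sum-remove; sum-replicate-zero)

open Equivalence using (to; from)

sumℤ≡sum : ∀ {k} (f : Fin k → ℤ) → sumℤ f ≡ sum f
sumℤ≡sum {zero}  f = refl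
sumℤ≡sum {suc k} f = cong (λ t → f zero + t) (sumℤ≡sum (λ i → f (suc i)))

sumℤ-cong : ∀ {k} {f g : Fin k → ℤ} → (∀ i → f i ≡ g i) → sumℤ f ≡ sumℤ g
sumℤ-cong {f = f} {g} f≗g rewrite sumℤ≡sum f | sumℤ≡sum g = sum-cong-≗ f≗g

sumℤ-+ : ∀ {k} (f g : Fin k → ℤ) → sumℤ (λ i → f i + g i) ≡ sumℤ f + sumℤ g
sumℤ-+ f g rewrite sumℤ≡sum f | sumℤ≡sum g | sumℤ≡sum (λ i → f i + g i) = ∑-distrib-+ f g

sumℤ-*ˡ : ∀ {k} (c : ℤ) (f : Fin k → ℤ) → sumℤ (λ i → c * f i) ≡ c * sumℤ f
sumℤ-*ˡ c f rewrite sumℤ≡sum f | sumℤ≡sum (λ i → c * f i) = sym (*-distribˡ-sum c f)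

sumℤ-neg : ∀ {k} (f : Fin k → ℤ) → sumℤ (λ i → - f i) ≡ - sumℤ f
sumℤ-neg f = trans (sumℤ-cong (λ i → sym (ℤP.-1*i≡-i (f i))))
                   (trans (sumℤ-*ˡ -1ℤ f) (ℤP.-1*i≡-i (sumℤ f)))

sumℤ-- : ∀ {k} (f g : Fin k → ℤ) → sumℤ (λ i → f i - g i) ≡ sumℤ f - sumℤ g
sumℤ-- f g = trans (sumℤ-+ f (λ i → - g i)) (cong (λ t → sumℤ f + t) (sumℤ-neg g))

sumℤ-init-last : ∀ {k} (f : Fin (suc k) → ℤ) →
                 sumℤ f ≡ sumℤ (λ i → f (inject₁ i)) + f (fromℕ k)
sumℤ-init-last f rewrite sumℤ≡sum f | sumℤ≡sum (λ i → f (inject₁ i)) = sum-init-last f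

sumℤ-concentrated : ∀ {k} (f : Fin (suc k) → ℤ) i → (∀ j → j ≢ i → f j ≡ 0ℤ) → sumℤ f ≡ f i
sumℤ-concentrated {k} f i f≡0 = begin
  sumℤ f                             ≡⟨ sumℤ≡sum f ⟩
  sum f                              ≡⟨ sum-remove f ⟩
  f i + sum (λ j → f (punchIn i j))  ≡⟨ cong (λ t → f i + t) rest≡0 ⟩
  f i + 0ℤ                           ≡⟨ ℤP.+-identityʳ (f i) ⟩
  f i                                ∎
  where
  open ≡-Reasoning
  rest≡0 : sum (λ j → f (punchIn i j)) ≡ 0ℤ
  rest≡0 = trans (sum-cong-≗ (λ j → f≡0 (punchIn i j) (punchInᵢ≢i i j))) (sum-replicate-zero k)

pos-sumℕ : ∀ {k} (f : Fin k → ℕ) → + sumℕ f ≡ sumℤ (λ i → + f i)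
pos-sumℕ {zero}  f = refl
pos-sumℕ {suc k} f = trans (ℤP.pos-+ (f zero) _) (cong (λ t → + f zero + t) (pos-sumℕ (λ i → f (suc i))))

∣-sumℤ : ∀ {k d} (f : Fin k → ℤ) → (∀ i → d ∣ℤ f i) → d ∣ℤ sumℤ f
∣-sumℤ {zero}  {d} f d∣f = ℤ∣.divides 0ℤ (sym (ℤP.*-zeroˡ d))
∣-sumℤ {suc k}     f d∣f = ℤ∣.∣m∣n⇒∣m+n (d∣f zero) (∣-sumℤ (λ i → f (suc i)) (λ i → d∣f (suc i)))

MinusOneExcept : ∀ {k} → Fin k → (Fin k → ℤ) → Set
MinusOneExcept i a = ∀ j → j ≢ i → a j ≡ -1ℤ

sumℤ-*-minusOneExcept : ∀ {k} {i : Fin (suc k)} {a} → MinusOneExcept i a → ∀ x →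
                         sumℤ (λ j → a j * x j) ≡ (a i + 1ℤ) * x i - sumℤ x
sumℤ-*-minusOneExcept {i = i} {a} a≡-1 x = begin
  sumℤ (λ j → a j * x j)                  ≡⟨ sumℤ-cong (λ j → shift (a j) (x j)) ⟩
  sumℤ (λ j → (a j + 1ℤ) * x j - x j)     ≡⟨ sumℤ-- (λ j → (a j + 1ℤ) * x j) x ⟩
  sumℤ (λ j → (a j + 1ℤ) * x j) - sumℤ x  ≡⟨ cong (_- sumℤ x) (sumℤ-concentrated _ i vanishes) ⟩
  (a i + 1ℤ) * x i - sumℤ x               ∎
  where
  open ≡-Reasoning
  shift : ∀ a x → a * x ≡ (a + 1ℤ) * x - x
  shift = solve-∀
  vanishes : ∀ j → j ≢ i → (a j + 1ℤ) * x j ≡ 0ℤ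
  vanishes j j≢i rewrite a≡-1 j j≢i = ℤP.*-zeroˡ (x j)

-- E = Σ_i b_i w_i E ≡ Σ_i b_i w_i q_i e_i = S Σ_i b_i e_i ≡ 0  (mod d).
common-multiple-has-trivial-torsion :
  ∀ {k} {d E S : ℤ} (w e q b : Fin k → ℤ) →
  (∀ i → q i * w i ≡ S) → (∀ i → d ∣ℤ q i * e i - E) →
  sumℤ (λ i → b i * w i) ≡ 1ℤ → d ∣ℤ sumℤ (λ i → b i * e i) → d ∣ℤ E
common-multiple-has-trivial-torsion {d = d} {E} {S} w e q b qw≡S d∣qe-E Σbw≡1 d∣Σbe =
  subst (d ∣ℤ_) (cancel (S * Σbe) E)
    (ℤ∣.∣m∣n⇒∣m-n (ℤ∣.∣n⇒∣m*n S d∣Σbe)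
      (subst (d ∣ℤ_) Σ≡ (∣-sumℤ _ (λ i → ℤ∣.∣n⇒∣m*n (b i * w i) (d∣qe-E i)))))
  where
  open ≡-Reasoning
  Σbe : ℤ
  Σbe = sumℤ (λ i → b i * e i)
  cancel : ∀ x y → x - (x - y) ≡ y
  cancel = solve-∀
  regroup : ∀ b w q e E → b * w * (q * e - E) ≡ q * w * (b * e) - E * (b * w)
  regroup = solve-∀
  Σ≡ : sumℤ (λ i → b i * w i * (q i * e i - E)) ≡ S * Σbe - E
  Σ≡ = begin
    sumℤ (λ i → b i * w i * (q i * e i - E))
      ≡⟨ sumℤ-cong (λ i → trans (regroup (b i) (w i) (q i) (e i) E)
                                (cong (λ t → t * (b i * e i) - E * (b i * w i)) (qw≡S i))) ⟩
    sumℤ (λ i → S * (b i * e i) - E * (b i * w i))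
      ≡⟨ sumℤ-- (λ i → S * (b i * e i)) (λ i → E * (b i * w i)) ⟩
    sumℤ (λ i → S * (b i * e i)) - sumℤ (λ i → E * (b i * w i))
      ≡⟨ cong₂ _-_ (sumℤ-*ˡ S (λ i → b i * e i)) (sumℤ-*ˡ E (λ i → b i * w i)) ⟩
    S * Σbe - E * sumℤ (λ i → b i * w i)
      ≡⟨ cong (λ t → S * Σbe - E * t) Σbw≡1 ⟩
    S * Σbe - E * 1ℤ
      ≡⟨ cong (λ t → S * Σbe - t) (ℤP.*-identityʳ E) ⟩
    S * Σbe - E
      ∎

divℕ[m,n]*n≡m : ∀ {m n} → n ∣ m → divℕ m n ℕ.* n ≡ m
divℕ[m,n]*n≡m {n = zero}  0∣m = sym (ℕD.0∣⇒≡0 0∣m)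
divℕ[m,n]*n≡m {n = suc _} n∣m = m/n*n≡m n∣m

divℕ[m,n]∣o⇔m∣o*n : ∀ {m n} o → 1 ≤ m → n ∣ m → divℕ m n ∣ o ⇔ m ∣ o ℕ.* n
divℕ[m,n]∣o⇔m∣o*n {suc _} {zero}  o _ 0∣m = ⊥-elim (ℕP.1+n≢0 (ℕD.0∣⇒≡0 0∣m))
divℕ[m,n]∣o⇔m∣o*n {m}     {suc _} o _ n∣m = mk⇔ (ℕD.m/n∣o⇒m∣o*n n∣m) (ℕD.m∣n*o⇒m/n∣o n∣m)

gcdWith[m,f]∣m : ∀ {k} m (f : Fin k → ℕ) → gcdWith m f ∣ m
gcdWith[m,f]∣m {zero}  m f = ℕD.∣-refl
gcdWith[m,f]∣m {suc k} m f =
  ℕD.∣-trans (gcd[m,n]∣m _ (f zero)) (gcdWith[m,f]∣m m (λ i → f (suc i)))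

gcdWith[m,f]∣f : ∀ {k} m (f : Fin k → ℕ) i → gcdWith m f ∣ f i
gcdWith[m,f]∣f m f zero    = gcd[m,n]∣n (gcdWith m (λ i → f (suc i))) (f zero)
gcdWith[m,f]∣f m f (suc i) =
  ℕD.∣-trans (gcd[m,n]∣m _ (f zero)) (gcdWith[m,f]∣f m (λ i → f (suc i)) i)

c*gcdWith-greatest : ∀ {k d} c m (f : Fin k → ℕ) →
                     d ∣ c ℕ.* m → (∀ i → d ∣ c ℕ.* f i) → d ∣ c ℕ.* gcdWith m f
c*gcdWith-greatest {zero}  c m f d∣cm d∣cf = d∣cm
c*gcdWith-greatest {suc k} c m f d∣cm d∣cf =
  subst (_ ∣_) (sym (c*gcd[m,n]≡gcd[cm,cn] c _ (f zero)))
    (gcd-greatest (c*gcdWith-greatest c m (λ i → f (suc i)) d∣cm (λ i → d∣cf (suc i))) (d∣cf zero))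

divℕ[m,gcdWith[m,f]]∣s⇔ : ∀ {k m} (f : Fin k → ℕ) s → 1 ≤ m →
                          divℕ m (gcdWith m f) ∣ s ⇔ (∀ i → m ∣ s ℕ.* f i)
divℕ[m,gcdWith[m,f]]∣s⇔ {m = m} f s 1≤m =
  mk⇔ (λ m∣sg i → ℕD.∣-trans m∣sg (ℕD.*-monoʳ-∣ s (gcdWith[m,f]∣f m f i)))
      (c*gcdWith-greatest s m f (ℕD.n∣m*n s))
  ⇔-∘ divℕ[m,n]∣o⇔m∣o*n s 1≤m (gcdWith[m,f]∣m m f)

f∣lcmAll : ∀ {k} (f : Fin k → ℕ) i → f i ∣ lcmAll f
f∣lcmAll f zero    = m∣lcm[m,n] (f zero) _
f∣lcmAll f (suc i) = ℕD.∣-trans (f∣lcmAll (λ i → f (suc i)) i) (n∣lcm[m,n] (f zero) _)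

lcmAll-least : ∀ {k c} (f : Fin k → ℕ) → (∀ i → f i ∣ c) → lcmAll f ∣ c
lcmAll-least {zero}  f f∣c = ℕD.1∣ _
lcmAll-least {suc k} f f∣c = lcm-least (f∣c zero) (lcmAll-least (λ i → f (suc i)) (λ i → f∣c (suc i)))

module _ {n r : ℕ} (w : Fin (suc n) → ℕ) (μ : Fin r → ℕ) (η : Fin (suc n) → Fin r → ℕ) where

  ση : Fin r → ℤ
  ση j = sumℤ (λ k → + η k j)

  -- q [D_i] = Σ_k [D_k] in ℤ ⊕ ⨁_j ℤ/μ_j.
  IsAnticanonical : Fin (suc n) → ℤ → Set
  IsAnticanonical i q = q * + w i ≡ + sumℕ w × (∀ j → + μ j ∣ℤ q * + η i j - ση j)

  InKernel : (Fin (suc n) → ℤ) → Set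
  InKernel a = φw w a ≡ + 0 × (∀ j → + μ j ℤD.∣ φη η a j)

  module _ {i : Fin (suc n)} {a : Fin (suc n) → ℤ} (a≡-1 : MinusOneExcept i a) where

    φw-minusOneExcept : φw w a ≡ (a i + 1ℤ) * + w i - + sumℕ w
    φw-minusOneExcept = trans (sumℤ-*-minusOneExcept a≡-1 (λ k → + w k))
                              (cong (λ t → (a i + 1ℤ) * + w i - t) (sym (pos-sumℕ w)))

    φη-minusOneExcept : ∀ j → φη η a j ≡ (a i + 1ℤ) * + η i j - ση j
    φη-minusOneExcept j = sumℤ-*-minusOneExcept a≡-1 (λ k → + η k j)

    inKernel⇔isAnticanonical : InKernel a ⇔ IsAnticanonical i (a i + 1ℤ)
    inKernel⇔isAnticanonical = mk⇔
      (λ (φw≡0 , μ∣φη) →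
         ℤP.i-j≡0⇒i≡j _ _ (trans (sym φw-minusOneExcept) φw≡0) ,
         λ j → subst (+ μ j ∣ℤ_) (φη-minusOneExcept j) (ℤ∣.∣ᵤ⇒∣ (μ∣φη j)))
      (λ (qw≡S , μ∣) →
         trans φw-minusOneExcept (ℤP.i≡j⇒i-j≡0 qw≡S) ,
         λ j → ℤ∣.∣⇒∣ᵤ (subst (+ μ j ∣ℤ_) (sym (φη-minusOneExcept j)) (μ∣ j)))

  gorenstein⇔anticanonicalMultiples :
    (P : Matrix n) → (∀ a → InKernel a ⇔ (∃[ m ] (∀ i → a i ≡ dot m (col P i)))) →
    Gorenstein P ⇔ (∀ i → ∃[ q ] IsAnticanonical i q)
  gorenstein⇔anticanonicalMultiples P kernel = mk⇔
    (λ gorenstein i → multiple (gorenstein i))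
    (λ multiples i → cone (multiples i))
    where
    multiple : ∀ {i} → ∃[ m ] MinusOneExcept i (λ k → dot m (col P k)) → ∃[ q ] IsAnticanonical i q
    multiple {i} (m , ⟨m,v⟩≡-1) =
      dot m (col P i) + 1ℤ , to (inKernel⇔isAnticanonical ⟨m,v⟩≡-1) (from (kernel _) (m , λ _ → refl))

    cone : ∀ {i} → ∃[ q ] IsAnticanonical i q → ∃[ m ] MinusOneExcept i (λ k → dot m (col P k))
    cone {i} (q , anticanonical) =
      map₂ (λ a≡⟨m,v⟩ k k≢i → trans (sym (a≡⟨m,v⟩ k)) (a≡-1 k k≢i)) (to (kernel a) inKernel)
      where
      a : Fin (suc n) → ℤ
      a = updateAt (λ _ → -1ℤ) i (λ x → q + x)
      a≡-1 : MinusOneExcept i a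
      a≡-1 k k≢i = updateAt-minimal k i (λ _ → -1ℤ) k≢i
      aᵢ+1≡q : a i + 1ℤ ≡ q
      aᵢ+1≡q = trans (cong (_+ 1ℤ) (updateAt-updates i (λ _ → -1ℤ)))
                     (trans (ℤP.+-assoc q -1ℤ 1ℤ) (ℤP.+-identityʳ q))
      inKernel : InKernel a
      inKernel = from (inKernel⇔isAnticanonical a≡-1)
                      (subst (IsAnticanonical i) (sym aᵢ+1≡q) anticanonical)

  GorensteinCriterion : Set
  GorensteinCriterion =
    (Lw w ∣ sumℕ w)
    × (∀ j → Mj w μ η j ∣ divℕ (sumℕ w) (Lw w))
    × (∀ j → (+ η (fromℕ n) j) ≡ - sumℤ (λ (i : Fin n) → + η (inject₁ i) j) [mod μ j ])

  torsion⇔lastCondition :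
    ∀ j → + μ j ∣ℤ ση j ⇔ ((+ η (fromℕ n) j) ≡ - sumℤ (λ (i : Fin n) → + η (inject₁ i) j) [mod μ j ])
  torsion⇔lastCondition j =
    mk⇔ (λ μ∣ση → ℤ∣.∣⇒∣ᵤ (subst (+ μ j ∣ℤ_) ση≡ μ∣ση))
        (λ μ∣ → subst (+ μ j ∣ℤ_) (sym ση≡) (ℤ∣.∣ᵤ⇒∣ μ∣))
    where
    swap : ∀ x y → x + y ≡ y - - x
    swap = solve-∀
    X : ℤ
    X = sumℤ (λ (i : Fin n) → + η (inject₁ i) j)
    ση≡ : ση j ≡ + η (fromℕ n) j - - X
    ση≡ = trans (sumℤ-init-last (λ k → + η k j)) (swap X (+ η (fromℕ n) j))

  module _ (w≥1 : ∀ i → 1 ≤ w i) (μ≥1 : ∀ j → 1 ≤ μ j) where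

    S L S/L : ℕ
    S = sumℕ w
    L = Lw w
    S/L = divℕ S L

    multiplier : Fin (suc n) → ℕ
    multiplier i = S/L ℕ.* divℕ L (w i)

    multiplier*w≡S : L ∣ S → ∀ i → multiplier i ℕ.* w i ≡ S
    multiplier*w≡S L∣S i = begin
      S/L ℕ.* divℕ L (w i) ℕ.* w i    ≡⟨ ℕP.*-assoc S/L _ (w i) ⟩
      S/L ℕ.* (divℕ L (w i) ℕ.* w i)  ≡⟨ cong (S/L ℕ.*_) (divℕ[m,n]*n≡m (f∣lcmAll w i)) ⟩
      S/L ℕ.* L                       ≡⟨ divℕ[m,n]*n≡m L∣S ⟩
      S                               ∎
      where open ≡-Reasoning

    q*w≡S⇒q≡multiplier : L ∣ S → ∀ {i} q → q * + w i ≡ + S → q ≡ + multiplier i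
    q*w≡S⇒q≡multiplier L∣S {i} q qw≡S =
      ℤP.*-cancelʳ-≡ q (+ multiplier i) (+ w i) {{ℕ.>-nonZero (w≥1 i)}}
        (trans qw≡S (trans (cong +_ (sym (multiplier*w≡S L∣S i))) (ℤP.pos-* (multiplier i) (w i))))

    multiplier*η : ∀ i j → + multiplier i * + η i j ≡ + (S/L ℕ.* Lij w η i j)
    multiplier*η i j = trans (sym (ℤP.pos-* (multiplier i) (η i j))) (cong +_ (ℕP.*-assoc S/L _ (η i j)))

    anticanonicalMultiple⇔μ∣S/L*Lij :
      L ∣ S → (∀ j → + μ j ∣ℤ ση j) → ∀ i →
      (∃[ q ] IsAnticanonical i q) ⇔ (∀ j → μ j ∣ S/L ℕ.* Lij w η i j)
    anticanonicalMultiple⇔μ∣S/L*Lij L∣S μ∣ση i = mk⇔ necessary sufficient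
      where
      necessary : ∃[ q ] IsAnticanonical i q → ∀ j → μ j ∣ S/L ℕ.* Lij w η i j
      necessary (q , qw≡S , μ∣qη-ση) j = ℤ∣.∣⇒∣ᵤ (subst (+ μ j ∣ℤ_) qη≡ μ∣qη)
        where
        μ∣qη : + μ j ∣ℤ q * + η i j
        μ∣qη = ℤ∣.∣m+n∣n⇒∣m {+ μ j} {q * + η i j} (μ∣qη-ση j) (ℤ∣.∣m⇒∣-m (μ∣ση j))
        qη≡ : q * + η i j ≡ + (S/L ℕ.* Lij w η i j)
        qη≡ = trans (cong (λ t → t * + η i j) (q*w≡S⇒q≡multiplier L∣S q qw≡S)) (multiplier*η i j)

      sufficient : (∀ j → μ j ∣ S/L ℕ.* Lij w η i j) → ∃[ q ] IsAnticanonical i q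
      sufficient μ∣S/L*Lij =
        + multiplier i ,
        trans (sym (ℤP.pos-* (multiplier i) (w i))) (cong +_ (multiplier*w≡S L∣S i)) ,
        λ j → ℤ∣.∣m∣n⇒∣m-n (subst (+ μ j ∣ℤ_) (sym (multiplier*η i j)) (ℤ∣.∣ᵤ⇒∣ (μ∣S/L*Lij j))) (μ∣ση j)

    anticanonicalMultiples⇔criterion :
      ∃[ b ] (φw w b ≡ 1ℤ × (∀ j → + μ j ∣ℤ φη η b j)) →
      (∀ i → ∃[ q ] IsAnticanonical i q) ⇔ GorensteinCriterion
    anticanonicalMultiples⇔criterion (b , φw≡1 , μ∣φη) = mk⇔ necessary sufficient
      where
      gcd-criterion : ∀ j → Mj w μ η j ∣ S/L ⇔ (∀ i → μ j ∣ S/L ℕ.* Lij w η i j)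
      gcd-criterion j = divℕ[m,gcdWith[m,f]]∣s⇔ (λ i → Lij w η i j) S/L (μ≥1 j)

      necessary : (∀ i → ∃[ q ] IsAnticanonical i q) → GorensteinCriterion
      necessary multiples =
        L∣S ,
        (λ j → from (gcd-criterion j) (λ i → to (anticanonicalMultiple⇔μ∣S/L*Lij L∣S μ∣ση i) (multiples i) j)) ,
        (λ j → to (torsion⇔lastCondition j) (μ∣ση j))
        where
        q : Fin (suc n) → ℤ
        q i = proj₁ (multiples i)
        qw≡S : ∀ i → q i * + w i ≡ + S
        qw≡S i = proj₁ (proj₂ (multiples i))
        L∣S : L ∣ S
        L∣S = lcmAll-least w (λ i → ℤ∣.∣⇒∣ᵤ {+ w i} {+ S} (ℤ∣.divides (q i) (sym (qw≡S i))))
        μ∣ση : ∀ j → + μ j ∣ℤ ση j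
        μ∣ση j = common-multiple-has-trivial-torsion (λ i → + w i) (λ i → + η i j) q b
                   qw≡S (λ i → proj₂ (proj₂ (multiples i)) j) φw≡1 (μ∣φη j)

      sufficient : GorensteinCriterion → ∀ i → ∃[ q ] IsAnticanonical i q
      sufficient (L∣S , M∣S/L , lastCondition) i =
        from (anticanonicalMultiple⇔μ∣S/L*Lij L∣S (λ j → from (torsion⇔lastCondition j) (lastCondition j)) i)
             (λ j → to (gcd-criterion j) (M∣S/L j) i)

unitPreimage : ∀ {n r} {P : Matrix n} {w μ η} → IsClIso {n} {r} P w μ η →
               ∃[ b ] (φw w b ≡ 1ℤ × (∀ j → + μ j ∣ℤ φη η b j))
unitPreimage {μ = μ} {η} iso with IsClIso.surjective iso 1ℤ (λ _ → 0ℤ)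
... | b , φw≡1 , μ∣φη-0 =
  b , φw≡1 , λ j → subst (+ μ j ∣ℤ_) (ℤP.+-identityʳ (φη η b j)) (ℤ∣.∣ᵤ⇒∣ (μ∣φη-0 j))

proposition4p1 :
    ∀ {n r : ℕ} (P : Matrix n) → IsFWPS P →
    (w : Fin (suc n) → ℕ) → (∀ i → 1 ≤ w i) →
    (μ : Fin r → ℕ) → (∀ j → 1 ≤ μ j) →
    (∀ (j k : Fin r) → j ≤ᶠ k → μ k ∣ μ j) →
    (η : Fin (suc n) → Fin r → ℕ) → (∀ i j → η i j < μ j) →
    IsClIso P w μ η →
    (Gorenstein P ⇔
      ((Lw w ∣ sumℕ w)
       × (∀ j → Mj w μ η j ∣ divℕ (sumℕ w) (Lw w))
       × (∀ j → (+ η (fromℕ n) j)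
                  ≡ - sumℤ (λ (i : Fin n) → + η (inject₁ i) j) [mod μ j ])))
proposition4p1 P _ w w≥1 μ μ≥1 _ η _ iso =
  anticanonicalMultiples⇔criterion w μ η w≥1 μ≥1 (unitPreimage iso)
  ⇔-∘ gorenstein⇔anticanonicalMultiples w μ η P (IsClIso.kernel iso)
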